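{- The rules ($\to\Rightarrow$) and ($\Rightarrow\to$) are $GK(A_m)^r$-invertible; that is, for all finite multisets $\Gamma,\Delta$ of $\mathcal{L}_{A_m}^{\Box}$-formulas and formulas $\varphi,\psi$: if $\Gamma,\varphi\to\psi\Rightarrow\Delta$ is $GK(A_m)^r$-derivable then so is $\Gamma,\psi\Rightarrow\varphi,\Delta$; and if $\Gamma\Rightarrow\varphi\to\psi,\Delta$ is $GK(A_m)^r$-derivable then so is $\Gamma,\varphi\Rightarrow\psi,\Delta$.
   Context: $\mathcal{L}_{A_m}^{\Box}$-formulas are built from a countably infinite set of variables using binary $\to$ and unary $\Box$. A sequent $\Gamma\Rightarrow\Delta$ is an ordered pair of finite multisets of formulas; $\Gamma,\Delta$ denotes multiset union ($\uplus$), $k\Gamma$ the union of $k$ copies of $\Gamma$, $k[\varphi]$ the multiset of $k$ copies of $\varphi$, $\Box\Gamma=[\Box\varphi:\varphi\in\Gamma]$. The calculus $GK(A_m)^r$ has exactly the rules: (ID) $\Delta\Rightarrow\Delta$ (no premises); ($\to\Rightarrow$) from $\Gamma,\psi\Rightarrow\varphi,\Delta$ infer $\Gamma,\varphi\to\psi\Rightarrow\Delta$; ($\Rightarrow\to$) from $\Gamma,\varphi\Rightarrow\psi,\Delta$ infer $\Gamma\Rightarrow\varphi\to\psi,\Delta$; and for each $k\ge1$, $n\ge0$, ($\Box_{k,n}$): from the premises $\Gamma_0\Rightarrow$ and $\Gamma_i\Rightarrow k[\varphi_i]$ for $i=1,\dots,n$ infer $\Delta,\Box\Gamma\Rightarrow\Box\varphi_1,\dots,\Box\varphi_n,\Delta$,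 provided $k\Gamma=\Gamma_0\uplus\Gamma_1\uplus\dots\uplus\Gamma_n$. A sequent is $GK(A_m)^r$-derivable if it is the root of a finite tree of sequents each node of which is obtained from its children by one of these rules. -}

module Defs where

open import Data.Nat using (ℕ; suc)
open import Data.List using (List; []; _∷_; _++_; map; concat; replicate; concatMap)
open import Data.Product using (_×_; _,_; proj₁; proj₂)
open import Data.List.Relation.Binary.Permutation.Propositional using (_↭_)
open import Data.List.Relation.Unary.All using (All)

data Fm : Set where
  var  : ℕ → Fm
  _⇒ᶠ_ : Fm → Fm → Fm
  □_   : Fm → Fm

infixr 5 _⇒ᶠ_

-- Finite multisets are represented by lists; multiset equality is
-- list permutation _↭_, and multiset union is _++_.
Multiset : Set
Multiset = List Fm

copies : ℕ → Multiset → Multiset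
copies k Γ = concat (replicate k Γ)

-- Derivability in GK(A_m)^r.  Every conclusion is stated up to multiset
-- equality (permutation) of both sides, since sequents are pairs of multisets.
data Der : Multiset → Multiset → Set where
  ID   : ∀ {Γ Δ Δ'} → Γ ↭ Δ → Δ' ↭ Δ → Der Γ Δ'
  →⇒   : ∀ {Γ Δ φ ψ Γ' Δ'} →
         Der (Γ ++ ψ ∷ []) (φ ∷ Δ) →
         Γ' ↭ (Γ ++ (φ ⇒ᶠ ψ) ∷ []) → Δ' ↭ Δ →
         Der Γ' Δ'
  ⇒→   : ∀ {Γ Δ φ ψ Γ' Δ'} →
         Der (Γ ++ φ ∷ []) (ψ ∷ Δ) →
         Γ' ↭ Γ → Δ' ↭ ((φ ⇒ᶠ ψ) ∷ Δ) →
         Der Γ' Δ'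
  -- (□_{k,n}) with k = suc k', n = length ps; ps lists the pairs (Γ_i , φ_i).
  box  : ∀ (k' : ℕ) {Γ Δ Γ₀ Γ' Δ'} (ps : List (Multiset × Fm)) →
         Der Γ₀ [] →
         All (λ p → Der (proj₁ p) (replicate (suc k') (proj₂ p))) ps →
         copies (suc k') Γ ↭ (Γ₀ ++ concatMap proj₁ ps) →
         Γ' ↭ (Δ ++ map □_ Γ) →
         Δ' ↭ (map (λ p → □ proj₂ p) ps ++ Δ) →
         Der Γ' Δ'

-- If φ ⇒ᶠ ψ is principal,
-- the premise is the required sequent; if the last rule is an implication rule
-- on another formula, invert its premise and reapply the rule.  Otherwise
-- φ ⇒ᶠ ψ lies in the weakening context of an axiom or a box rule (a box rule
-- introduces only boxed formulas).  That context occurs on both sides, so we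
-- redo the rule with φ and ψ added to it and then reintroduce φ ⇒ᶠ ψ on the
-- side opposite to the one it is to be removed from.
module Submission where

open import Defs
open import Data.List using (List; []; _∷_; _++_; map)
open import Data.List.Membership.Propositional using (_∈_; _∉_)
open import Data.List.Membership.Propositional.Properties using (∈-∃++; ∈-++⁻; ∈-map⁻)
open import Data.List.Relation.Binary.Permutation.Propositional
open import Data.List.Relation.Binary.Permutation.Propositional.Properties
  using (∈-resp-↭; shift; shifts; drop-∷; ∷↭∷ʳ; ++⁺ˡ; ++⁺ʳ)
open import Data.List.Relation.Unary.Any using (here; there)
open import Data.Empty using (⊥-elim)
open import Data.Product using (_×_; _,_; ∃; proj₂)
open import Data.Sum using (_⊎_; inj₁; inj₂; [_,_]′)
open import Function using (id; _∘_)
open import Relation.Binary.PropositionalEquality using (_≡_; refl)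

private
  variable
    A : Set
    x y : A
    xs ys : List A
    φ ψ : Fm
    Γ Γ′ Δ Δ′ : Multiset

∷ʳ↭∷ : ∀ (x : A) xs → xs ++ x ∷ [] ↭ x ∷ xs
∷ʳ↭∷ x xs = ↭-sym (∷↭∷ʳ x xs)

∈⇒↭∷ : x ∈ xs → ∃ λ rest → xs ↭ x ∷ rest
∈⇒↭∷ {x = x} x∈xs with ∈-∃++ x∈xs
... | ys , zs , refl = ys ++ zs , shift x ys zs

∷↭∷⇒≡⊎↭ : x ∷ xs ↭ y ∷ ys →
          (x ≡ y × xs ↭ ys) ⊎ ∃ λ rest → ys ↭ x ∷ rest × xs ↭ y ∷ rest
∷↭∷⇒≡⊎↭ {x = x} {y = y} x∷xs↭y∷ys with ∈-resp-↭ x∷xs↭y∷ys (here refl)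
... | here refl = inj₁ (refl , drop-∷ x∷xs↭y∷ys)
... | there x∈ys with ∈⇒↭∷ x∈ys
...   | rest , ys↭x∷rest =
  inj₂ (rest , ys↭x∷rest ,
        drop-∷ (↭-trans x∷xs↭y∷ys (↭-trans (↭-prep y ys↭x∷rest) (↭-swap y x ↭-refl))))

⇒ᶠ∉map-□ : ∀ (f : A → Fm) xs → (φ ⇒ᶠ ψ) ∉ map (λ a → □ f a) xs
⇒ᶠ∉map-□ f xs i with ∈-map⁻ (λ a → □ f a) i
... | _ , _ , ()

⇒ᶠ∈-++-boxed : ∀ (f : A → Fm) xs → (φ ⇒ᶠ ψ) ∈ Δ ++ map (λ a → □ f a) xs → (φ ⇒ᶠ ψ) ∈ Δ
⇒ᶠ∈-++-boxed {Δ = Δ} f xs i = [ id , ⊥-elim ∘ ⇒ᶠ∉map-□ f xs ]′ (∈-++⁻ Δ i)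

⇒ᶠ∈-boxed-++ : ∀ (f : A → Fm) xs → (φ ⇒ᶠ ψ) ∈ map (λ a → □ f a) xs ++ Δ → (φ ⇒ᶠ ψ) ∈ Δ
⇒ᶠ∈-boxed-++ f xs i = [ ⊥-elim ∘ ⇒ᶠ∉map-□ f xs , id ]′ (∈-++⁻ (map _ xs) i)

Der-resp-↭ : Der Γ Δ → Γ ↭ Γ′ → Δ ↭ Δ′ → Der Γ′ Δ′
Der-resp-↭ (ID p q)   Γ↭ Δ↭ = ID (↭-trans (↭-sym Γ↭) p) (↭-trans (↭-sym Δ↭) q)
Der-resp-↭ (→⇒ d p q) Γ↭ Δ↭ = →⇒ d (↭-trans (↭-sym Γ↭) p) (↭-trans (↭-sym Δ↭) q)
Der-resp-↭ (⇒→ d p q) Γ↭ Δ↭ = ⇒→ d (↭-trans (↭-sym Γ↭) p) (↭-trans (↭-sym Δ↭) q)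
Der-resp-↭ (box k ps d₀ ds split p q) Γ↭ Δ↭ =
  box k ps d₀ ds split (↭-trans (↭-sym Γ↭) p) (↭-trans (↭-sym Δ↭) q)

ψ∷Γ⊢φ∷φ⇒ᶠψ∷Γ : ∀ Γ φ ψ → Der (ψ ∷ Γ) (φ ∷ (φ ⇒ᶠ ψ) ∷ Γ)
ψ∷Γ⊢φ∷φ⇒ᶠψ∷Γ Γ φ ψ =
  ⇒→ {Γ = ψ ∷ Γ} {Δ = φ ∷ Γ} (ID (↭-prep ψ (∷ʳ↭∷ φ Γ)) ↭-refl) ↭-refl (↭-swap φ _ ↭-refl)

φ∷φ⇒ᶠψ∷Δ⊢ψ∷Δ : ∀ Δ φ ψ → Der (φ ∷ (φ ⇒ᶠ ψ) ∷ Δ) (ψ ∷ Δ)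
φ∷φ⇒ᶠψ∷Δ⊢ψ∷Δ Δ φ ψ =
  →⇒ {Γ = φ ∷ Δ} {Δ = ψ ∷ Δ} (ID (↭-prep φ (∷ʳ↭∷ ψ Δ)) ↭-refl)
     (↭-prep φ (∷↭∷ʳ _ Δ)) ↭-refl

→⇒-inversion : ∀ {Γ φ ψ Γ′ Δ′} → Der Γ′ Δ′ → Γ′ ↭ (φ ⇒ᶠ ψ) ∷ Γ → Der (ψ ∷ Γ) (φ ∷ Δ′)
→⇒-inversion {Γ = Γ} {φ = φ} {ψ = ψ} (ID Γ′↭ Δ′↭) Γ′↭⇒ᶠ∷Γ =
  Der-resp-↭ (ψ∷Γ⊢φ∷φ⇒ᶠψ∷Γ Γ φ ψ) ↭-refl
             (↭-prep φ (↭-sym (↭-trans Δ′↭ (↭-trans (↭-sym Γ′↭) Γ′↭⇒ᶠ∷Γ))))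
→⇒-inversion {Γ = Γ} {φ = φ} {ψ = ψ} (→⇒ {G} {D} {a} {b} d Γ′↭ Δ′↭) Γ′↭⇒ᶠ∷Γ
  with ∷↭∷⇒≡⊎↭ (↭-trans (↭-sym Γ′↭⇒ᶠ∷Γ) (↭-trans Γ′↭ (∷ʳ↭∷ (a ⇒ᶠ b) G)))
... | inj₁ (refl , Γ↭G) =
  Der-resp-↭ d (↭-trans (∷ʳ↭∷ ψ G) (↭-prep ψ (↭-sym Γ↭G))) (↭-prep φ (↭-sym Δ′↭))
... | inj₂ (R , G↭ , Γ↭) =
  →⇒ {Γ = ψ ∷ R} {Δ = φ ∷ D}
     (Der-resp-↭ inverted (↭-prep ψ (∷↭∷ʳ b R)) (↭-swap φ a ↭-refl))
     (↭-prep ψ (↭-trans Γ↭ (∷↭∷ʳ _ R)))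
     (↭-prep φ Δ′↭)
  where
  inverted : Der (ψ ∷ b ∷ R) (φ ∷ a ∷ D)
  inverted = →⇒-inversion d (↭-trans (∷ʳ↭∷ b G) (↭-trans (↭-prep b G↭) (↭-swap b _ ↭-refl)))
→⇒-inversion {Γ = Γ} {φ = φ} {ψ = ψ} (⇒→ {G} {D} {a} {b} d Γ′↭ Δ′↭) Γ′↭⇒ᶠ∷Γ =
  ⇒→ {Γ = ψ ∷ Γ} {Δ = φ ∷ D}
     (Der-resp-↭ inverted (↭-prep ψ (∷↭∷ʳ a Γ)) (↭-swap φ b ↭-refl))
     ↭-refl
     (↭-trans (↭-prep φ Δ′↭) (↭-swap φ _ ↭-refl))
  where
  inverted : Der (ψ ∷ a ∷ Γ) (φ ∷ b ∷ D)
  inverted = →⇒-inversion d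
    (↭-trans (∷ʳ↭∷ a G) (↭-trans (↭-prep a (↭-trans (↭-sym Γ′↭) Γ′↭⇒ᶠ∷Γ)) (↭-swap a _ ↭-refl)))
→⇒-inversion {Γ = Γ} {φ = φ} {ψ = ψ} (box k {L} {D} ps d₀ ds split Γ′↭ Δ′↭) Γ′↭⇒ᶠ∷Γ
  with ∈⇒↭∷ (⇒ᶠ∈-++-boxed id L (∈-resp-↭ (↭-trans (↭-sym Γ′↭⇒ᶠ∷Γ) Γ′↭) (here refl)))
... | R , D↭ =
  ⇒→ {Γ = ψ ∷ Γ} {Δ = φ ∷ boxes ++ R}
     (box k {L} {ψ ∷ φ ∷ R} ps d₀ ds split
          (↭-prep ψ (↭-trans (∷ʳ↭∷ φ Γ) (↭-prep φ Γ↭)))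
          (shifts (ψ ∷ φ ∷ []) boxes))
     ↭-refl
     (↭-trans (↭-prep φ (↭-trans Δ′↭ (↭-trans (++⁺ˡ boxes D↭) (shift _ boxes R))))
              (↭-swap φ _ ↭-refl))
  where
  boxes : Multiset
  boxes = map (λ p → □ proj₂ p) ps
  Γ↭ : Γ ↭ R ++ map □_ L
  Γ↭ = drop-∷ (↭-trans (↭-sym Γ′↭⇒ᶠ∷Γ) (↭-trans Γ′↭ (++⁺ʳ (map □_ L) D↭)))

⇒→-inversion : ∀ {Δ φ ψ Γ′ Δ′} → Der Γ′ Δ′ → Δ′ ↭ (φ ⇒ᶠ ψ) ∷ Δ → Der (φ ∷ Γ′) (ψ ∷ Δ)
⇒→-inversion {Δ = Δ} {φ = φ} {ψ = ψ} (ID Γ′↭ Δ′↭) Δ′↭⇒ᶠ∷Δ =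
  Der-resp-↭ (φ∷φ⇒ᶠψ∷Δ⊢ψ∷Δ Δ φ ψ)
             (↭-prep φ (↭-sym (↭-trans Γ′↭ (↭-trans (↭-sym Δ′↭) Δ′↭⇒ᶠ∷Δ))))
             ↭-refl
⇒→-inversion {Δ = Δ} {φ = φ} {ψ = ψ} (→⇒ {G} {D} {a} {b} d Γ′↭ Δ′↭) Δ′↭⇒ᶠ∷Δ =
  →⇒ {Γ = φ ∷ G} {Δ = ψ ∷ Δ}
     (Der-resp-↭ inverted ↭-refl (↭-swap ψ a ↭-refl))
     (↭-prep φ Γ′↭)
     ↭-refl
  where
  inverted : Der (φ ∷ G ++ b ∷ []) (ψ ∷ a ∷ Δ)
  inverted = ⇒→-inversion d
    (↭-trans (↭-prep a (↭-trans (↭-sym Δ′↭) Δ′↭⇒ᶠ∷Δ)) (↭-swap a _ ↭-refl))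
⇒→-inversion {Δ = Δ} {φ = φ} {ψ = ψ} (⇒→ {G} {D} {a} {b} d Γ′↭ Δ′↭) Δ′↭⇒ᶠ∷Δ
  with ∷↭∷⇒≡⊎↭ (↭-trans (↭-sym Δ′↭⇒ᶠ∷Δ) Δ′↭)
... | inj₁ (refl , Δ↭D) =
  Der-resp-↭ d (↭-trans (∷ʳ↭∷ φ G) (↭-prep φ (↭-sym Γ′↭))) (↭-prep ψ (↭-sym Δ↭D))
... | inj₂ (R , D↭ , Δ↭) =
  ⇒→ {Γ = φ ∷ G} {Δ = ψ ∷ R}
     (Der-resp-↭ inverted ↭-refl (↭-swap ψ b ↭-refl))
     (↭-prep φ Γ′↭)
     (↭-trans (↭-prep ψ Δ↭) (↭-swap ψ _ ↭-refl))
  where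
  inverted : Der (φ ∷ G ++ a ∷ []) (ψ ∷ b ∷ R)
  inverted = ⇒→-inversion d (↭-trans (↭-prep b D↭) (↭-swap b _ ↭-refl))
⇒→-inversion {Δ = Δ} {φ = φ} {ψ = ψ} (box k {L} {D} ps d₀ ds split Γ′↭ Δ′↭) Δ′↭⇒ᶠ∷Δ
  with ∈⇒↭∷ (⇒ᶠ∈-boxed-++ proj₂ ps (∈-resp-↭ (↭-trans (↭-sym Δ′↭⇒ᶠ∷Δ) Δ′↭) (here refl)))
... | R , D↭ =
  →⇒ {Γ = φ ∷ R ++ map □_ L} {Δ = ψ ∷ Δ}
     (box k {L} {φ ∷ ψ ∷ R} ps d₀ ds split
          (↭-prep φ (∷ʳ↭∷ ψ (R ++ map □_ L)))
          (↭-trans (↭-prep φ (↭-prep ψ Δ↭)) (shifts (φ ∷ ψ ∷ []) boxes)))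
     (↭-prep φ (↭-trans Γ′↭ (↭-trans (++⁺ʳ (map □_ L) D↭) (∷↭∷ʳ _ (R ++ map □_ L)))))
     ↭-refl
  where
  boxes : Multiset
  boxes = map (λ p → □ proj₂ p) ps
  Δ↭ : Δ ↭ boxes ++ R
  Δ↭ = drop-∷ (↭-trans (↭-sym Δ′↭⇒ᶠ∷Δ)
                       (↭-trans Δ′↭ (↭-trans (++⁺ˡ boxes D↭) (shift _ boxes R))))

lemma4p4 : (∀ (Γ Δ : Multiset) (φ ψ : Fm) →
               Der (Γ ++ (φ ⇒ᶠ ψ) ∷ []) Δ → Der (Γ ++ ψ ∷ []) (φ ∷ Δ))
             × (∀ (Γ Δ : Multiset) (φ ψ : Fm) →
               Der Γ ((φ ⇒ᶠ ψ) ∷ Δ) → Der (Γ ++ φ ∷ []) (ψ ∷ Δ))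
lemma4p4 =
  (λ Γ Δ φ ψ d → Der-resp-↭ (→⇒-inversion d (∷ʳ↭∷ _ Γ)) (∷↭∷ʳ ψ Γ) ↭-refl) ,
  (λ Γ Δ φ ψ d → Der-resp-↭ (⇒→-inversion d ↭-refl) (∷↭∷ʳ φ Γ) ↭-refl)
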